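{- In the $(1:1)$ WMaker--WBreaker game on $E(K_n)$, by playing according to strategy $\mathcal{S}$, WMaker can build a path of length $n-3$ (with $n-2$ vertices) in $n-3$ moves.
   Context: The $(1:1)$ WMaker--WBreaker game on $E(K_n)$: WMaker and WBreaker alternately claim one edge of $K_n$ per turn; both are walkers: at the first move a player chooses any starting vertex; when positioned at $v$, a player may only claim an edge incident with $v$ not previously claimed by the opponent, and its other endpoint becomes the new position. WBreaker starts; a round is a move of WBreaker followed by a move of WMaker. $M$ and $B$ denote the graphs of edges claimed so far by WMaker and WBreaker; $V(M)$ is the set of vertices incident with at least one WMaker edge, and $U=V(K_n)\setminus V(M)$. An edge is free if claimed by neither player. $d_B(x)$ is the degree of $x$ in $B$. Strategy $\mathcal{S}$ for WMaker: as her starting vertex she takes the vertex $v_1$ at which WBreaker finished his first move, and claims an edge $v_1u$ with $d_B(u)=0$ (ties arbitrary). In every later round, with current position $w$: if there is an edge $pq\in E(B)$ with $p,q\in U$, she claims $wp$ or $wq$, whichever is free; if both are free she chooses $wp$ if $d_B(p)>d_B(q)$ and $wq$ if $d_B(q)>d_B(p)$ (ties arbitrary). If no such edge exists, then, as long as $|U|\ge 3$, she claims a free edge $wu$ with $u\in U$ and $d_B(u)=\max\{d_B(v):v\in U\}$ (ties arbitrary); if all free edges $wu$ are such that $d_B(u)=0$ for all $u\in U$, she claims an arbitrary free edge $wu$. -}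

module Defs where

open import Data.Nat using (ℕ; zero; suc; _≤_; _<_; _∸_)
open import Data.Fin using (Fin)
open import Data.Fin.Properties using (_≟_)
open import Data.Bool using (Bool; true; false; _∧_; _∨_; not)
open import Data.List using (List; upTo; allFin; filterᵇ; length)
open import Data.Bool.ListAction using (any)
open import Data.Product using (Σ; _×_; ∃)
open import Data.Sum using (_⊎_)
open import Relation.Nullary using (¬_)
open import Relation.Nullary.Decidable using (⌊_⌋)
open import Relation.Binary.PropositionalEquality using (_≡_; _≢_)

-- A walker's play is encoded by its sequence of positions  w : ℕ → Fin n ;
-- its j-th move (j = 0,1,2,...) claims the edge {w j , w (suc j)}.
-- WBreaker's positions are  b , WMaker's positions are  m .
-- Round r (r = 0,1,2,...) consists of WBreaker claiming {b r , b (suc r)}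
-- followed by WMaker claiming {m r , m (suc r)}.
-- So just before WMaker's move in round r:
--   B = WBreaker edges with index j < suc r,
--   M = WMaker edges with index j < r.

module _ {n : ℕ} where

  _==_ : Fin n → Fin n → Bool
  x == y = ⌊ x ≟ y ⌋

  sameEdge : Fin n → Fin n → Fin n → Fin n → Bool
  sameEdge a b x y = ((a == x) ∧ (b == y)) ∨ ((a == y) ∧ (b == x))

  inWalk : (ℕ → Fin n) → ℕ → Fin n → Fin n → Bool
  inWalk w k x y = any (λ j → sameEdge (w j) (w (suc j)) x y) (upTo k)

  inV : (ℕ → Fin n) → ℕ → Fin n → Bool
  inV w k x = any (λ y → inWalk w k x y) (allFin n)

  deg : (ℕ → Fin n) → ℕ → Fin n → ℕ
  deg w k x = length (filterᵇ (λ y → inWalk w k x y) (allFin n))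

  module AtRound (b m : ℕ → Fin n) (r : ℕ) where

    inB : Fin n → Fin n → Bool
    inB = inWalk b (suc r)

    inM : Fin n → Fin n → Bool
    inM = inWalk m r

    dB : Fin n → ℕ
    dB = deg b (suc r)

    inU : Fin n → Bool
    inU x = not (inV m r x)

    sizeU : ℕ
    sizeU = length (filterᵇ inU (allFin n))

    free : Fin n → Fin n → Set
    free x y = (x ≢ y) × (inB x y ≡ false) × (inM x y ≡ false)

    w : Fin n
    w = m r

    BEdgeInU : Set
    BEdgeInU = Σ (Fin n) λ p → Σ (Fin n) λ q →
                 (inB p q ≡ true) × (inU p ≡ true) × (inU q ≡ true)

    SFirst : Fin n → Set
    SFirst v = (w ≢ v) × (dB v ≡ 0)

    SLater : Fin n → Set
    SLater v =
      ( BEdgeInU ×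
        Σ (Fin n) λ q → (inB v q ≡ true) × (inU v ≡ true) × (inU q ≡ true)
          × free w v × (free w q → dB q ≤ dB v) )
      ⊎
      ( ¬ BEdgeInU × 3 ≤ sizeU × (inU v ≡ true) × free w v
        × (∀ u → inU u ≡ true → free w u → dB u ≤ dB v) )

  -- moving to v (i.e. claiming {m r , v}) in round r is allowed by S
  -- (for some tie-breaking)
  SMoveTo : (b m : ℕ → Fin n) → ℕ → Fin n → Set
  SMoveTo b m zero    v = AtRound.SFirst b m zero v
  SMoveTo b m (suc r) v = AtRound.SLater b m (suc r) v

  BLegal : (b m : ℕ → Fin n) → ℕ → Set
  BLegal b m r = (b r ≢ b (suc r)) × (inWalk m r (b r) (b (suc r)) ≡ false)

  SMove : (b m : ℕ → Fin n) → ℕ → Set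
  SMove b m r = SMoveTo b m r (m (suc r))

  PlayS : (b m : ℕ → Fin n) → ℕ → Set
  PlayS b m k = (m 0 ≡ b 1) × (∀ r → r < k → BLegal b m r)
                × (∀ r → r < k → SMove b m r)

  MakerPath : (m : ℕ → Fin n) → ℕ → Set
  MakerPath m k = ∀ i j → i ≤ k → j ≤ k → m i ≡ m j → i ≡ j

-- The proof maintains two invariants at the start of each round r: WBreaker
-- has no edge inside U = V(K_n) ∖ {m₀, …, m_r}, and WMaker's position has at
-- most one B-neighbour in U.  After WBreaker's move an edge of B inside U must
-- therefore be his new edge pq, and WMaker cannot be B-adjacent to both p and
-- q (both would be her unique neighbour, yet p ≠ q), so one of wp, wq is free.
-- Otherwise at most two vertices of U are B-adjacent to her, and
-- |U| ≥ n − r − 1 ≥ 3 leaves a free edge into U while r < n − 3.  Either way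
-- WMaker steps into U, which restores the invariants and keeps her positions
-- pairwise distinct.
module Submission where

open import Defs
open import Data.Bool using (Bool; true; false; T; _∧_; not)
open import Data.Bool.Properties using (T-≡; T-∨; T-∧; T-not-≡; ∨-zeroʳ; not-¬) renaming (_≟_ to _≟ᵇ_)
open import Data.Bool.ListAction using (any)
open import Data.Empty using (⊥; ⊥-elim)
open import Data.Fin using (Fin)
open import Data.Fin.Properties using (_≟_; any?)
open import Data.List using (List; []; _∷_; upTo; allFin; filter; filterᵇ; length; map; _++_)
open import Data.List.Properties using (length-map; length-upTo; length-++; length-tabulate)
open import Data.List.Membership.Propositional using (_∈_; find; lose)
open import Data.List.Membership.Propositional.Properties
  using (∈-allFin; ∈-upTo⁺; ∈-upTo⁻; ∈-map⁺; ∈-++⁺ˡ; ∈-++⁺ʳ; ∈-filter⁺; ∈-filter⁻)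
open import Data.List.Relation.Unary.All as All using ()
open import Data.List.Relation.Unary.AllPairs using (_∷_)
open import Data.List.Relation.Unary.Any using (here; there)
open import Data.List.Relation.Unary.Any.Properties using (any⁺; any⁻)
open import Data.List.Relation.Unary.Unique.Propositional using (Unique)
open import Data.List.Relation.Unary.Unique.Propositional.Properties using (allFin⁺)
open import Data.Nat using (ℕ; zero; suc; _+_; _≤_; _<_; _∸_; z≤n; s≤s)
open import Data.Nat.Properties
  using (≤-totalOrder; ≤-total; ≤-refl; ≤-trans; <-trans; <⇒≤; n<1+n; m≤n⇒m≤1+n; m<1+n⇒m<n∨m≡n;
         +-suc; +-comm; +-cancelʳ-≤; <-cmp)
open import Data.List.Extrema ≤-totalOrder using (argmax; argmax-all; f[xs]≤f[argmax])
open import Data.Product as Product using (Σ; ∃-syntax; _×_; _,_; proj₁; proj₂)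
open import Data.Sum as Sum using (_⊎_; inj₁; inj₂)
open import Function.Base using (_∘_)
open import Function.Bundles using (module Equivalence)
open import Relation.Binary.Definitions using (tri<; tri≈; tri>)
open import Relation.Binary.PropositionalEquality using (_≡_; _≢_; refl; sym; trans; cong; subst)
open import Relation.Nullary using (¬_; Dec; yes; no; ¬?; _×-dec_)
open import Relation.Nullary.Decidable using (toWitness; toWitnessFalse)
open import Relation.Unary using (Decidable)

open Equivalence using (to; from)

module _ {A : Set} where

  any≡true⁻ : (p : A → Bool) (xs : List A) → any p xs ≡ true → ∃[ x ] x ∈ xs × p x ≡ true
  any≡true⁻ p xs e = Product.map₂ (Product.map₂ (to T-≡)) (find (any⁻ p xs (from T-≡ e)))

  any≡true⁺ : (p : A → Bool) {xs : List A} {x : A} → x ∈ xs → p x ≡ true → any p xs ≡ true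
  any≡true⁺ p x∈xs px = to T-≡ (any⁺ p (lose x∈xs (from T-≡ px)))

  filterᵇ-nonempty⁻ : (p : A → Bool) (xs : List A) → 0 < length (filterᵇ p xs) → ∃[ x ] p x ≡ true
  filterᵇ-nonempty⁻ p (x ∷ xs) nonempty with p x in px
  ... | true  = x , px
  ... | false = filterᵇ-nonempty⁻ p xs nonempty

  filterᵇ-empty⁻ : (p : A → Bool) (xs : List A) {x : A} → length (filterᵇ p xs) ≡ 0 → x ∈ xs → p x ≡ false
  filterᵇ-empty⁻ p (y ∷ xs) empty x∈ with p y in py
  filterᵇ-empty⁻ p (y ∷ xs) ()    x∈          | true
  filterᵇ-empty⁻ p (y ∷ xs) empty (here refl) | false = py
  filterᵇ-empty⁻ p (y ∷ xs) empty (there x∈)  | false = filterᵇ-empty⁻ p xs empty x∈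

  filterᵇ-empty⁺ : (p : A → Bool) (xs : List A) → (∀ x → p x ≡ false) → length (filterᵇ p xs) ≡ 0
  filterᵇ-empty⁺ p []       none = refl
  filterᵇ-empty⁺ p (y ∷ xs) none rewrite none y = filterᵇ-empty⁺ p xs none

  remove-member : {x : A} {L : List A} → x ∈ L →
    ∃[ L′ ] length L ≡ suc (length L′) × (∀ {y} → y ∈ L → y ≢ x → y ∈ L′)
  remove-member {L = _ ∷ L} (here refl) = L , refl , λ where
    (here refl) y≢x → ⊥-elim (y≢x refl)
    (there y∈)  _   → y∈
  remove-member {L = a ∷ L} (there x∈) with L′ , len , keep ← remove-member x∈ =
    a ∷ L′ , cong suc len , λ where
      (here refl) _   → here refl
      (there y∈)  y≢x → there (keep y∈ y≢x)

  length≤count+length : (p : A → Bool) {xs : List A} → Unique xs → (L : List A) →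
    (∀ {x} → x ∈ xs → p x ≡ false → x ∈ L) → length xs ≤ length (filterᵇ p xs) + length L
  length≤count+length p {[]}     _            L exceptions = z≤n
  length≤count+length p {x ∷ xs} (x∉xs ∷ xs!) L exceptions with p x in px
  ... | true  = s≤s (length≤count+length p xs! L (λ y∈ → exceptions (there y∈)))
  ... | false with L′ , len , keep ← remove-member (exceptions (here refl) px)
    rewrite len | +-suc (length (filterᵇ p xs)) (length L′) =
      s≤s (length≤count+length p xs! L′ λ {y} y∈ py →
        keep (exceptions (there y∈) py) λ { refl → All.lookup x∉xs y∈ refl })

module _ {n : ℕ} where

  count : (Fin n → Bool) → ℕ
  count p = length (filterᵇ p (allFin n))

  n≤count+exceptions : (p : Fin n → Bool) (L : List (Fin n)) →
    (∀ x → p x ≡ false → x ∈ L) → n ≤ count p + length L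
  n≤count+exceptions p L exceptions =
    subst (_≤ count p + length L) (length-tabulate (λ x → x))
      (length≤count+length p (allFin⁺ n) L (λ {x} _ → exceptions x))

  few-exceptions⇒∃ : (p : Fin n → Bool) (L : List (Fin n)) → length L < n →
    (∀ x → p x ≡ false → x ∈ L) → ∃[ x ] p x ≡ true
  few-exceptions⇒∃ p L L<n exceptions = filterᵇ-nonempty⁻ p (allFin n)
    (+-cancelʳ-≤ (length L) 1 (count p) (≤-trans L<n (n≤count+exceptions p L exceptions)))

  argmax-∃ : {P : Fin n → Set} → Decidable P → (f : Fin n → ℕ) → Σ (Fin n) P →
    ∃[ v ] P v × (∀ u → P u → f u ≤ f v)
  argmax-∃ P? f (c , Pc) =
    v , argmax-all f {xs = xs} Pc (All.tabulate (proj₂ ∘ ∈-filter⁻ P? {xs = allFin n})) ,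
    λ u Pu → All.lookup (f[xs]≤f[argmax] c xs) (∈-filter⁺ P? (∈-allFin u) Pu)
    where
      xs : List (Fin n)
      xs = filter P? (allFin n)
      v : Fin n
      v = argmax f c xs

  ==⇒≡ : {x y : Fin n} → x == y ≡ true → x ≡ y
  ==⇒≡ {x} {y} e = toWitness {a? = x ≟ y} (from T-≡ e)

  ==-refl : (x : Fin n) → x == x ≡ true
  ==-refl x with x ≟ x
  ... | yes _   = refl
  ... | no x≢x = ⊥-elim (x≢x refl)

  sameEdge≡true⁻ : {a c x y : Fin n} → sameEdge a c x y ≡ true → (a ≡ x × c ≡ y) ⊎ (a ≡ y × c ≡ x)
  sameEdge≡true⁻ e = Sum.map both both (to T-∨ (from T-≡ e))
    where
      both : {a x c y : Fin n} → T ((a == x) ∧ (c == y)) → a ≡ x × c ≡ y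
      both {a} {x} {c} {y} t =
        Product.map (toWitness {a? = a ≟ x}) (toWitness {a? = c ≟ y}) (to T-∧ t)

  sameEdge≡true⁺ : {a c x y : Fin n} → (a ≡ x × c ≡ y) ⊎ (a ≡ y × c ≡ x) → sameEdge a c x y ≡ true
  sameEdge≡true⁺ {a} {c} (inj₁ (refl , refl)) rewrite ==-refl a | ==-refl c = refl
  sameEdge≡true⁺ {a} {c} (inj₂ (refl , refl)) rewrite ==-refl a | ==-refl c = ∨-zeroʳ _

  EdgeAt : (ℕ → Fin n) → ℕ → Fin n → Fin n → Set
  EdgeAt w j x y = (w j ≡ x × w (suc j) ≡ y) ⊎ (w j ≡ y × w (suc j) ≡ x)

  inWalk⁻ : (w : ℕ → Fin n) (k : ℕ) {x y : Fin n} → inWalk w k x y ≡ true → ∃[ j ] j < k × EdgeAt w j x y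
  inWalk⁻ w k e with j , j∈ , same ← any≡true⁻ _ (upTo k) e = j , ∈-upTo⁻ j∈ , sameEdge≡true⁻ same

  inWalk⁺ : (w : ℕ → Fin n) {k : ℕ} {x y : Fin n} (j : ℕ) → j < k → EdgeAt w j x y → inWalk w k x y ≡ true
  inWalk⁺ w j j<k edge = any≡true⁺ (λ j → sameEdge (w j) (w (suc j)) _ _) (∈-upTo⁺ j<k) (sameEdge≡true⁺ edge)

  inWalk-sym : (w : ℕ → Fin n) (k : ℕ) {x y : Fin n} → inWalk w k x y ≡ true → inWalk w k y x ≡ true
  inWalk-sym w k e with j , j<k , edge ← inWalk⁻ w k e = inWalk⁺ w j j<k (Sum.swap edge)

  inWalk-suc⁻ : (w : ℕ → Fin n) (k : ℕ) {x y : Fin n} →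
    inWalk w (suc k) x y ≡ true → inWalk w k x y ≡ true ⊎ EdgeAt w k x y
  inWalk-suc⁻ w k e with j , j<1+k , edge ← inWalk⁻ w (suc k) e with m<1+n⇒m<n∨m≡n j<1+k
  ... | inj₁ j<k  = inj₁ (inWalk⁺ w j j<k edge)
  ... | inj₂ refl = inj₂ edge

  EdgeAt-endpoint : {w : ℕ → Fin n} {j : ℕ} {x y v u : Fin n} → EdgeAt w j x y → EdgeAt w j v u → v ≡ x ⊎ v ≡ y
  EdgeAt-endpoint (inj₁ (refl , refl)) (inj₁ (refl , refl)) = inj₁ refl
  EdgeAt-endpoint (inj₁ (refl , refl)) (inj₂ (refl , refl)) = inj₂ refl
  EdgeAt-endpoint (inj₂ (refl , refl)) (inj₁ (refl , refl)) = inj₂ refl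
  EdgeAt-endpoint (inj₂ (refl , refl)) (inj₂ (refl , refl)) = inj₁ refl

  EdgeAt-loop : {w : ℕ → Fin n} {j : ℕ} {x : Fin n} → EdgeAt w j x x → w j ≡ w (suc j)
  EdgeAt-loop (inj₁ (wj≡x , w1+j≡x)) = trans wj≡x (sym w1+j≡x)
  EdgeAt-loop (inj₂ (wj≡x , w1+j≡x)) = trans wj≡x (sym w1+j≡x)

  otherEnd : (ℕ → Fin n) → ℕ → Fin n → Fin n
  otherEnd w j v with w j ≟ v
  ... | yes _ = w (suc j)
  ... | no _  = w j

  EdgeAt⇒≡otherEnd : {w : ℕ → Fin n} {j : ℕ} {v u : Fin n} → EdgeAt w j v u → u ≡ otherEnd w j v
  EdgeAt⇒≡otherEnd {w} {j} (inj₁ (refl , refl)) with w j ≟ w j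
  ... | yes _    = refl
  ... | no wj≢wj = ⊥-elim (wj≢wj refl)
  EdgeAt⇒≡otherEnd {w} {j} (inj₂ (refl , refl)) with w j ≟ w (suc j)
  ... | yes wj≡v = wj≡v
  ... | no _     = refl

module _ {n : ℕ} (b m : ℕ → Fin n) where

  Visited : ℕ → Fin n → Set
  Visited k x = ∃[ i ] i ≤ k × x ≡ m i

  Unvisited : ℕ → Fin n → Set
  Unvisited k x = ¬ Visited k x

  visited-here : (k : ℕ) → Visited k (m k)
  visited-here k = k , ≤-refl , refl

  Visited-suc : {k : ℕ} {x : Fin n} → Visited k x → Visited (suc k) x
  Visited-suc (i , i≤k , refl) = i , m≤n⇒m≤1+n i≤k , refl

  Unvisited-pred : {k : ℕ} {x : Fin n} → Unvisited (suc k) x → Unvisited k x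
  Unvisited-pred unvisited = unvisited ∘ Visited-suc

  Visited⇒∈positions : {k : ℕ} {x : Fin n} → Visited k x → x ∈ map m (upTo (suc k))
  Visited⇒∈positions (i , i≤k , refl) = ∈-map⁺ m (∈-upTo⁺ (s≤s i≤k))

  inWalk-m⇒Visited : (k : ℕ) {x y : Fin n} → inWalk m k x y ≡ true → Visited k x × Visited k y
  inWalk-m⇒Visited k e with inWalk⁻ m k e
  ... | j , j<k , inj₁ (refl , refl) = (j , <⇒≤ j<k , refl) , (suc j , j<k , refl)
  ... | j , j<k , inj₂ (refl , refl) = (suc j , j<k , refl) , (j , <⇒≤ j<k , refl)

  inV⇒Visited : (k : ℕ) {x : Fin n} → inV m k x ≡ true → Visited k x
  inV⇒Visited k e with _ , _ , edge ← any≡true⁻ _ (allFin n) e = proj₁ (inWalk-m⇒Visited k edge)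

  -- WMaker's first position m 0 is visited but lies on no edge of M until she
  -- has moved, hence the index suc r.
  Visited⇒inV : (r : ℕ) {x : Fin n} → Visited (suc r) x → inV m (suc r) x ≡ true
  Visited⇒inV r (zero , _ , refl) =
    any≡true⁺ _ (∈-allFin (m 1)) (inWalk⁺ m {suc r} 0 (s≤s z≤n) (inj₁ (refl , refl)))
  Visited⇒inV r (suc i , s≤s i≤r , refl) =
    any≡true⁺ _ (∈-allFin (m i)) (inWalk⁺ m {suc r} i (s≤s i≤r) (inj₂ (refl , refl)))

  inU⇒Unvisited : (r : ℕ) {x : Fin n} → AtRound.inU b m (suc r) x ≡ true → Unvisited (suc r) x
  inU⇒Unvisited r inU visited rewrite Visited⇒inV r visited with inU
  ... | ()

  Unvisited⇒inU : (r : ℕ) {x : Fin n} → Unvisited (suc r) x → AtRound.inU b m (suc r) x ≡ true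
  Unvisited⇒inU r {x} unvisited with inV m (suc r) x in inV
  ... | true  = ⊥-elim (unvisited (inV⇒Visited (suc r) inV))
  ... | false = refl

  laterMove-inU : (r : ℕ) {v : Fin n} → AtRound.SLater b m r v → AtRound.inU b m r v ≡ true
  laterMove-inU r (inj₁ (_ , _ , _ , inU-v , _)) = inU-v
  laterMove-inU r (inj₂ (_ , _ , inU-v , _))     = inU-v

  newPosition-unvisited : {K : ℕ} → PlayS b m K → (r : ℕ) → r < K → Unvisited r (m (suc r))
  newPosition-unvisited (_ , _ , moves) zero    r<K (zero , _ , m1≡m0) = proj₁ (moves 0 r<K) (sym m1≡m0)
  newPosition-unvisited (_ , _ , moves) (suc r) r<K = inU⇒Unvisited r (laterMove-inU (suc r) (moves (suc r) r<K))

  makerPath : (K : ℕ) → PlayS b m K → MakerPath m K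
  makerPath K play i j i≤K j≤K mi≡mj with <-cmp i j
  ... | tri≈ _ i≡j _ = i≡j
  makerPath K play i (suc j) _ j<K mi≡mj | tri< (s≤s i≤j) _ _ =
    ⊥-elim (newPosition-unvisited play j j<K (i , i≤j , sym mi≡mj))
  makerPath K play (suc i) j i<K _ mi≡mj | tri> _ _ (s≤s j≤i) =
    ⊥-elim (newPosition-unvisited play i i<K (j , j≤i , mi≡mj))

  -- Invariants at the start of round k, when B consists of WBreaker's first k
  -- edges and WMaker stands at m k, having visited m 0, …, m k.
  UnvisitedIndependent : ℕ → Set
  UnvisitedIndependent k = ∀ x y → inWalk b k x y ≡ true → Unvisited k x → Unvisited k y → ⊥

  UniqueUnvisitedNeighbour : ℕ → Set
  UniqueUnvisitedNeighbour k = ∃[ z ] ∀ u → Unvisited k u → inWalk b k (m k) u ≡ true → u ≡ z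

  unvisitedIndependent : {K : ℕ} → PlayS b m K → (r : ℕ) → r < K → UnvisitedIndependent (suc r)
  unvisitedIndependent (m0≡b1 , _ , _) zero _ x y e ux uy with inWalk-suc⁻ b 0 e
  ... | inj₂ (inj₁ (_ , b1≡y)) = uy (0 , z≤n , trans (sym b1≡y) (sym m0≡b1))
  ... | inj₂ (inj₂ (_ , b1≡x)) = ux (0 , z≤n , trans (sym b1≡x) (sym m0≡b1))
  unvisitedIndependent play@(_ , _ , moves) (suc r) r<K x y e ux uy
    with inWalk-suc⁻ b (suc r) e
  ... | inj₁ old = unvisitedIndependent play r (<-trans (n<1+n r) r<K) x y old (Unvisited-pred ux) (Unvisited-pred uy)
  ... | inj₂ new with moves (suc r) r<K
  ...   | inj₂ (noEdgeInU , _) =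
          noEdgeInU (x , y , e , Unvisited⇒inU r (Unvisited-pred ux) , Unvisited⇒inU r (Unvisited-pred uy))
  ...   | inj₁ (_ , q , vq , inU-v , inU-q , _) with inWalk-suc⁻ b (suc r) vq
  ...     | inj₁ old = unvisitedIndependent play r (<-trans (n<1+n r) r<K) _ q old
                         (inU⇒Unvisited r inU-v) (inU⇒Unvisited r inU-q)
  ...     | inj₂ new′ with EdgeAt-endpoint {w = b} new new′
  ...       | inj₁ refl = ux (visited-here _)
  ...       | inj₂ refl = uy (visited-here _)

  uniqueUnvisitedNeighbour : {K : ℕ} → PlayS b m K → (r : ℕ) → r < K → UniqueUnvisitedNeighbour (suc r)
  uniqueUnvisitedNeighbour (_ , _ , moves) zero r<K = m 0 , λ u _ e → ⊥-elim (isolated u e)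
    where
      isolated : ∀ u → inWalk b 1 (m 1) u ≡ true → ⊥
      isolated u e with trans (sym e) (filterᵇ-empty⁻ _ (allFin n) (proj₂ (moves 0 r<K)) (∈-allFin u))
      ... | ()
  uniqueUnvisitedNeighbour play (suc r) r<K = otherEnd b (suc r) (m (suc (suc r))) , unique
    where
      unique : ∀ u → Unvisited (suc (suc r)) u → inWalk b (suc (suc r)) (m (suc (suc r))) u ≡ true →
               u ≡ otherEnd b (suc r) (m (suc (suc r)))
      unique u uu e with inWalk-suc⁻ b (suc r) e
      ... | inj₁ old = ⊥-elim (unvisitedIndependent play r (<-trans (n<1+n r) r<K) _ u old
                                 (newPosition-unvisited play (suc r) r<K) (Unvisited-pred uu))
      ... | inj₂ new = EdgeAt⇒≡otherEnd {w = b} new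

  firstMove : PlayS b m 0 → 2 < n → Σ (Fin n) (AtRound.SFirst b m 0)
  firstMove (m0≡b1 , _ , _) 2<n =
    x , (λ m0≡x → x≢b1 (trans (sym m0≡x) m0≡b1)) , filterᵇ-empty⁺ _ (allFin n) noEdge
    where
      avoidsB : Fin n → Bool
      avoidsB x = not (x == b 0) ∧ not (x == b 1)
      found : ∃[ x ] avoidsB x ≡ true
      found = few-exceptions⇒∃ avoidsB (b 0 ∷ b 1 ∷ []) 2<n endpoints
        where
          endpoints : ∀ x → avoidsB x ≡ false → x ∈ b 0 ∷ b 1 ∷ []
          endpoints x _  with x == b 0 in x≈b0 | x == b 1 in x≈b1
          endpoints x _  | true  | _    = here (==⇒≡ x≈b0)
          endpoints x _  | false | true = there (here (==⇒≡ x≈b1))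
          endpoints x () | false | false
      x : Fin n
      x = proj₁ found
      x≢b0 : x ≢ b 0
      x≢b0 = toWitnessFalse {a? = x ≟ b 0} (proj₁ (to T-∧ (from T-≡ (proj₂ found))))
      x≢b1 : x ≢ b 1
      x≢b1 = toWitnessFalse {a? = x ≟ b 1} (proj₂ (to T-∧ (from T-≡ (proj₂ found))))
      noEdge : ∀ y → inWalk b 1 x y ≡ false
      noEdge y with inWalk b 1 x y in e
      ... | false = refl
      ... | true with inWalk⁻ b 1 e
      ...   | zero , _ , inj₁ (b0≡x , _) = ⊥-elim (x≢b0 (sym b0≡x))
      ...   | zero , _ , inj₂ (_ , b1≡x) = ⊥-elim (x≢b1 (sym b1≡x))
      ...   | suc _ , s≤s () , _

  module Round (r : ℕ) (play : PlayS b m (suc r)) (legal : BLegal b m (suc r))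
               (room : 4 + suc r ≤ n) where

    K : ℕ
    K = suc r

    open AtRound b m K

    visited-w : Visited K w
    visited-w = visited-here K

    uniqueNeighbour : UniqueUnvisitedNeighbour K
    uniqueNeighbour = uniqueUnvisitedNeighbour play r (n<1+n r)

    z : Fin n
    z = proj₁ uniqueNeighbour

    unvisitedNeighbour : ∀ {u} → Unvisited K u → inB w u ≡ true → u ≡ z ⊎ EdgeAt b K w u
    unvisitedNeighbour {u} uu e = Sum.map₁ (proj₂ uniqueNeighbour u uu) (inWalk-suc⁻ b K e)

    unvisited-free : ∀ {v} → inU v ≡ true → inB w v ≡ false → free w v
    unvisited-free {v} inU-v notB = (λ w≡v → uv (subst (Visited K) w≡v visited-w)) , notB , notM
      where
        uv : Unvisited K v
        uv = inU⇒Unvisited r inU-v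
        notM : inM w v ≡ false
        notM with inM w v in e
        ... | true  = ⊥-elim (uv (proj₂ (inWalk-m⇒Visited K e)))
        ... | false = refl

    moveInsideEdge : BEdgeInU → Σ (Fin n) SLater
    moveInsideEdge edgeInU@(p , q , pq , inU-p , inU-q) = choose
      where
        up : Unvisited K p
        up = inU⇒Unvisited r inU-p
        uq : Unvisited K q
        uq = inU⇒Unvisited r inU-q
        new : EdgeAt b K p q
        new with inWalk-suc⁻ b K pq
        ... | inj₁ old  = ⊥-elim (unvisitedIndependent play r (n<1+n r) p q old up uq)
        ... | inj₂ edge = edge
        -- w is visited, so it is not an endpoint of the new edge pq
        neighbour≡z : ∀ {u} → Unvisited K u → inB w u ≡ true → u ≡ z
        neighbour≡z uu e with unvisitedNeighbour uu e
        ... | inj₁ u≡z = u≡z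
        ... | inj₂ wu with EdgeAt-endpoint {w = b} new wu
        ...   | inj₁ w≡p = ⊥-elim (up (subst (Visited K) w≡p visited-w))
        ...   | inj₂ w≡q = ⊥-elim (uq (subst (Visited K) w≡q visited-w))
        notBoth : inB w p ≡ true → inB w q ≡ true → ⊥
        notBoth wp wq = proj₁ legal (EdgeAt-loop {w = b} (subst (EdgeAt b K p) (sym p≡q) new))
          where
            p≡q : p ≡ q
            p≡q = trans (neighbour≡z up wp) (sym (neighbour≡z uq wq))
        towards : ∀ v q → inB v q ≡ true → inU v ≡ true → inU q ≡ true → inB w v ≡ false →
                  (free w q → dB q ≤ dB v) → SLater v
        towards v q vq inU-v inU-q notB cmp =
          inj₁ (edgeInU , q , vq , inU-v , inU-q , unvisited-free inU-v notB , cmp)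
        choose : Σ (Fin n) SLater
        choose with inB w p in wp | inB w q in wq
        ... | true  | true  = ⊥-elim (notBoth wp wq)
        ... | false | true  = p , towards p q pq inU-p inU-q wp λ (_ , notB , _) → ⊥-elim (not-¬ wq notB)
        ... | true  | false = q , towards q p (inWalk-sym b (suc K) pq) inU-q inU-p wq
                                  λ (_ , notB , _) → ⊥-elim (not-¬ wp notB)
        ... | false | false with ≤-total (dB q) (dB p)
        ...   | inj₁ q≤p = p , towards p q pq inU-p inU-q wp λ _ → q≤p
        ...   | inj₂ p≤q = q , towards q p (inWalk-sym b (suc K) pq) inU-q inU-p wq λ _ → p≤q

    positions : List (Fin n)
    positions = map m (upTo (suc K))

    length-positions : length positions ≡ suc K
    length-positions = trans (length-map m (upTo (suc K))) (length-upTo (suc K))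

    outsideU⇒∈positions : ∀ x → inU x ≡ false → x ∈ positions
    outsideU⇒∈positions x _ with inV m K x in e
    outsideU⇒∈positions x ()   | false
    outsideU⇒∈positions x _    | true = Visited⇒∈positions (inV⇒Visited K e)

    U-large : 3 ≤ sizeU
    U-large = +-cancelʳ-≤ (suc K) 3 sizeU (≤-trans room
      (subst (λ t → n ≤ sizeU + t) length-positions (n≤count+exceptions inU positions outsideU⇒∈positions)))

    freeIntoU : Σ (Fin n) λ u → inU u ≡ true × free w u
    freeIntoU = u , inU-u , unvisited-free inU-u notB
      where
        -- the visited vertices, then the only possible B-neighbours of w in U
        exceptions : List (Fin n)
        exceptions = positions ++ z ∷ otherEnd b K w ∷ []
        short : length exceptions < n
        short = subst (λ t → suc t ≤ n)
          (sym (trans (length-++ positions) (trans (cong (_+ 2) length-positions) (+-comm (suc K) 2)))) room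
        blocked : ∀ u → inU u ∧ not (inB w u) ≡ false → u ∈ exceptions
        blocked u _ with inU u in inU-u | inB w u in wu
        blocked u _ | false | _    = ∈-++⁺ˡ (outsideU⇒∈positions u inU-u)
        blocked u _ | true  | true with unvisitedNeighbour (inU⇒Unvisited r inU-u) wu
        ... | inj₁ u≡z = ∈-++⁺ʳ positions (here u≡z)
        ... | inj₂ wu′ = ∈-++⁺ʳ positions (there (here (EdgeAt⇒≡otherEnd {w = b} wu′)))
        blocked u () | true  | false
        found : ∃[ u ] inU u ∧ not (inB w u) ≡ true
        found = few-exceptions⇒∃ (λ u → inU u ∧ not (inB w u)) exceptions short blocked
        u : Fin n
        u = proj₁ found
        inU-u : inU u ≡ true
        inU-u = to T-≡ (proj₁ (to T-∧ (from T-≡ (proj₂ found))))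
        notB : inB w u ≡ false
        notB = to T-not-≡ (proj₂ (to (T-∧ {inU u}) (from T-≡ (proj₂ found))))

    free? : Decidable λ u → inU u ≡ true × free w u
    free? u = (inU u ≟ᵇ true) ×-dec ¬? (w ≟ u) ×-dec (inB w u ≟ᵇ false) ×-dec (inM w u ≟ᵇ false)

    moveToMaxDegree : ¬ BEdgeInU → Σ (Fin n) SLater
    moveToMaxDegree noEdgeInU =
      let v , (inU-v , free-v) , maximal = argmax-∃ free? dB freeIntoU in
      v , inj₂ (noEdgeInU , U-large , inU-v , free-v , λ u inU-u free-u → maximal u (inU-u , free-u))

    BEdgeInU? : Dec BEdgeInU
    BEdgeInU? = any? λ p → any? λ q → (inB p q ≟ᵇ true) ×-dec (inU p ≟ᵇ true) ×-dec (inU q ≟ᵇ true)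

    laterMove : Σ (Fin n) SLater
    laterMove with BEdgeInU?
    ... | yes edgeInU   = moveInsideEdge edgeInU
    ... | no noEdgeInU = moveToMaxDegree noEdgeInU

k<n∸3⇒4+k≤n : (n k : ℕ) → k < n ∸ 3 → 4 + k ≤ n
k<n∸3⇒4+k≤n (suc (suc (suc n))) k k<n∸3 = s≤s (s≤s (s≤s k<n∸3))

corollary3 : (n : ℕ) →
    -- S is always applicable during the first n-3 rounds
    ((b m : ℕ → Fin n) (k : ℕ) → k < n ∸ 3 → PlayS b m k → BLegal b m k →
       Σ (Fin n) λ v → SMoveTo b m k v)
    ×
    -- after n-3 rounds played with S, WMaker's edges form a path of length n-3
    ((b m : ℕ → Fin n) → PlayS b m (n ∸ 3) → MakerPath m (n ∸ 3))
corollary3 n = applicable , λ b m → makerPath b m (n ∸ 3)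
  where
    applicable : (b m : ℕ → Fin n) (k : ℕ) → k < n ∸ 3 → PlayS b m k → BLegal b m k →
                 Σ (Fin n) λ v → SMoveTo b m k v
    applicable b m zero    k<n∸3 play _     = firstMove b m play (<⇒≤ (k<n∸3⇒4+k≤n n 0 k<n∸3))
    applicable b m (suc r) k<n∸3 play legal = Round.laterMove b m r play legal (k<n∸3⇒4+k≤n n (suc r) k<n∸3)
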